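{- Let $G$ be a graph containing no cycles of lengths $4$, $5$ and $6$, and let $xy\in E(G)$ with $N(x)\cap N(y)=\varnothing$, $d(x)\ge 2$ and $d(y)\ge 2$. Then the following are equivalent: (1) neither $x$ nor $y$ is a shedding vertex; (2) $xy$ is a relating edge.
   Context: Graphs are finite, simple, undirected. $N(v)$ denotes the neighbourhood of $v$, $N[v]=N(v)\cup\{v\}$, $d(v)=|N(v)|$, and for $S\subseteq V(G)$, $N[S]=\bigcup_{v\in S}N[v]$. A set is independent if its vertices are pairwise nonadjacent; an independent set is maximal if it is not properly contained in another independent set. A vertex $v$ is shedding if for every independent set $S\subseteq V(G)\setminus N[v]$ there exists $u\in N(v)$ such that $S\cup\{u\}$ is independent. An edge $xy$ is relating if there exists an independent set $S\subseteq V(G)\setminus N[\{x,y\}]$ such that both $S\cup\{x\}$ and $S\cup\{y\}$ are maximal independent sets of $G$. -}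

module Defs where

open import Data.Nat using (ℕ; zero; suc; _≤_)
open import Data.Bool using (Bool; true; false)
open import Data.Fin using (Fin; zero; suc; inject₁; fromℕ)
open import Data.Fin.Subset using (Subset; _∈_; _∉_; _⊆_; _∪_; ⁅_⁆; ∣_∣)
open import Data.Vec using (tabulate)
open import Data.Product using (Σ; ∃; _×_)
open import Data.Empty using (⊥)
open import Relation.Nullary using (¬_)
open import Relation.Binary.PropositionalEquality using (_≡_; _≢_)
open import Function.Definitions using (Injective)

record Graph : Set where
  field
    n     : ℕ
    adj   : Fin n → Fin n → Bool
    sym   : ∀ u v → adj u v ≡ adj v u
    irrefl : ∀ v → adj v v ≡ false

module _ (G : Graph) where
  open Graph G

  V : Set
  V = Fin n

  Adj : V → V → Set
  Adj u v = adj u v ≡ true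

  Nbhd : V → Subset n
  Nbhd v = tabulate (λ u → adj v u)

  deg : V → ℕ
  deg v = ∣ Nbhd v ∣

  HasCycle : ℕ → Set
  HasCycle zero = ⊥
  HasCycle (suc m) =
    Σ (Fin (suc m) → V) λ f →
      Injective _≡_ _≡_ f
      × (∀ (i : Fin m) → Adj (f (inject₁ i)) (f (suc i)))
      × Adj (f (fromℕ m)) (f zero)

  Independent : Subset n → Set
  Independent S = ∀ u v → u ∈ S → v ∈ S → ¬ Adj u v

  _⊂_ : Subset n → Subset n → Set
  S ⊂ T = S ⊆ T × S ≢ T

  MaximalIndependent : Subset n → Set
  MaximalIndependent S =
    Independent S × (∀ T → Independent T → ¬ (S ⊂ T))

  AvoidsClosedNbhd : Subset n → V → Set
  AvoidsClosedNbhd S v = ∀ u → u ∈ S → u ≢ v × ¬ Adj v u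

  Shedding : V → Set
  Shedding v =
    ∀ S → Independent S → AvoidsClosedNbhd S v →
      ∃ λ u → Adj v u × Independent (S ∪ ⁅ u ⁆)

  Relating : V → V → Set
  Relating x y =
    ∃ λ S → Independent S × AvoidsClosedNbhd S x × AvoidsClosedNbhd S y
      × MaximalIndependent (S ∪ ⁅ x ⁆) × MaximalIndependent (S ∪ ⁅ y ⁆)

-- Call S a witness for x when S is independent, avoids N[x] and dominates N(x); a vertex is
-- non-shedding exactly when it has a witness. If xy is relating via S and z is a neighbour
-- of y other than x, then (S ∖ N(z)) ∪ {z} is a witness for x: a neighbour u ≠ y of x is
-- dominated by some s ∈ S, and s ~ z would close the 5-cycle x u s z y. Conversely, from
-- witnesses Sx, Sy keep the vertices of Sx at distance two from x and of Sy at distance two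
-- from y; there are no C4s, so these lie outside N[{x,y}], and there are no C6s, so their union
-- is independent. Extending it greedily to an independent set of G - N[{x,y}] that dominates
-- G - N[{x,y}] gives a set S with S ∪ {x} and S ∪ {y} both maximal.
module Submission where

open import Defs
open import Data.Nat using (_≤_)
open import Data.Product using (_×_)
open import Relation.Nullary using (¬_)
open import Function.Bundles using (_⇔_; mk⇔)

open import Level using (0ℓ)
open import Data.Nat using (suc; s≤s)
open import Data.Nat.Properties using (≤-trans)
open import Data.Bool using (Bool; true)
open import Data.Bool.Properties using (T-≡) renaming (_≟_ to _≟ᵇ_)
open import Data.Fin using (Fin; zero; suc; inject₁; fromℕ; _≟_)
open import Data.Fin.Properties using (any?; all?)
open import Data.Fin.Subset using (Subset; _∈_; _∉_; _⊆_; _∪_; ⁅_⁆)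
open import Data.Fin.Subset.Properties
  using (_∈?_; x∈⁅x⁆; x∈⁅y⁆⇒x≡y; x∈⁅y⁆⇔x≡y; ∣⁅x⁆∣≡1; p⊆q⇒∣p∣≤∣q∣; ⊆-antisym;
         p⊆p∪q; q⊆p∪q; x∈p∪q⁻; anySubset?)
open import Data.Vec using (Vec; []; _∷_; lookup; tabulate)
open import Data.Vec.Properties using (lookup∘tabulate; []=⇒lookup; lookup⇒[]=)
open import Data.Vec.Relation.Unary.All using ([]; _∷_)
open import Data.Vec.Relation.Unary.AllPairs using ([]; _∷_)
open import Data.Vec.Relation.Unary.Linked using (Linked; [-]; _∷_)
open import Data.Vec.Relation.Unary.Unique.Propositional using (Unique)
open import Data.Vec.Relation.Unary.Unique.Propositional.Properties using (lookup-injective)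
open import Data.List using (List; []; _∷_; allFin)
open import Data.List.Membership.Propositional using () renaming (_∈_ to _∈ˡ_)
open import Data.List.Membership.Propositional.Properties using (∈-allFin)
open import Data.List.Relation.Unary.Any using (here; there)
open import Data.Product using (∃; _,_; proj₁; proj₂; swap)
open import Data.Sum using (inj₁; inj₂; [_,_])
open import Function.Bundles using (Equivalence)
open import Relation.Binary.Core using (Rel)
open import Relation.Binary.PropositionalEquality using (_≡_; _≢_; refl; sym; trans; subst; ≢-sym)
open import Function.Base using (_∘_)
open import Relation.Nullary using (Dec; yes; no; contradiction)
open import Relation.Nullary.Decidable using (_×-dec_; _→-dec_; ¬?; isYes; decidable-stable; toWitness; fromWitness)
open import Relation.Unary using (Pred; Decidable)

open Equivalence using (to; from)

lookup-linked : ∀ {A : Set} {R : Rel A 0ℓ} {m} {xs : Vec A (suc m)} →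
                Linked R xs → ∀ i → R (lookup xs (inject₁ i)) (lookup xs (suc i))
lookup-linked {xs = _ ∷ _ ∷ _} (r ∷ rs) zero    = r
lookup-linked {xs = _ ∷ _ ∷ _} (r ∷ rs) (suc i) = lookup-linked rs i

∈-tabulate : ∀ {n} {f : Fin n → Bool} {i} → i ∈ tabulate f ⇔ f i ≡ true
∈-tabulate {f = f} {i} = mk⇔
  (λ i∈ → trans (sym (lookup∘tabulate f i)) ([]=⇒lookup i∈))
  (λ fi → lookup⇒[]= i _ (trans (lookup∘tabulate f i) fi))

module _ {n} {P : Pred (Fin n) 0ℓ} (P? : Decidable P) where

  toSubset : Subset n
  toSubset = tabulate (λ i → isYes (P? i))

  ∈-toSubset : ∀ {i} → i ∈ toSubset ⇔ P i
  ∈-toSubset {i} = mk⇔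
    (λ i∈ → toWitness {a? = P? i} (from T-≡ (to ∈-tabulate i∈)))
    (λ Pi → from ∈-tabulate (to T-≡ (fromWitness {a? = P? i} Pi)))

module Properties (G : Graph) where
  open Graph G using (n; adj; irrefl)

  private
    variable
      a b s u v x y z : V G
      S T U Sx Sy : Subset n

  adj? : ∀ u v → Dec (Adj G u v)
  adj? u v = adj u v ≟ᵇ true

  adj-sym : Adj G u v → Adj G v u
  adj-sym {u} {v} uv = trans (Graph.sym G v u) uv

  adj⇒≢ : Adj G u v → u ≢ v
  adj⇒≢ {u} uu refl with () ← trans (sym uu) (irrefl u)

  ∈Nbhd⇔adj : u ∈ Nbhd G v ⇔ Adj G v u
  ∈Nbhd⇔adj = ∈-tabulate

  deg≥2⇒other-neighbour : ∀ x y → 2 ≤ deg G y → ∃ λ z → Adj G y z × z ≢ x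
  deg≥2⇒other-neighbour x y 2≤deg =
    decidable-stable (any? λ z → adj? y z ×-dec ¬? (z ≟ x)) λ none →
      contradiction (≤-trans 2≤deg (subst (deg G y ≤_) (∣⁅x⁆∣≡1 x) (p⊆q⇒∣p∣≤∣q∣ (Nbhd⊆⁅x⁆ none))))
                    λ { (s≤s ()) }
    where
    Nbhd⊆⁅x⁆ : ¬ (∃ λ z → Adj G y z × z ≢ x) → Nbhd G y ⊆ ⁅ x ⁆
    Nbhd⊆⁅x⁆ none {z} z∈N = from x∈⁅y⁆⇔x≡y
      (decidable-stable (z ≟ x) λ z≢x → none (z , to ∈Nbhd⇔adj z∈N , z≢x))

  cycle : ∀ {m} (vs : Vec (V G) (suc m)) → Unique vs → Linked (Adj G) vs →
          Adj G (lookup vs (fromℕ m)) (lookup vs zero) → HasCycle G (suc m)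
  cycle vs unique path closing =
    lookup vs , (λ {i} {j} → lookup-injective unique i j) , lookup-linked path , closing

  C4-free⇒common-neighbour-unique : ¬ HasCycle G 4 → u ≢ v →
    Adj G u a → Adj G a v → Adj G u b → Adj G b v → a ≡ b
  C4-free⇒common-neighbour-unique {u} {v} {a} {b} ¬C4 u≢v ua av ub bv =
    decidable-stable (a ≟ b) λ a≢b → ¬C4 (cycle (u ∷ a ∷ v ∷ b ∷ [])
      ((adj⇒≢ ua ∷ u≢v ∷ adj⇒≢ ub ∷ []) ∷ (adj⇒≢ av ∷ a≢b ∷ []) ∷
       (adj⇒≢ (adj-sym bv) ∷ []) ∷ [] ∷ [])
      (ua ∷ av ∷ adj-sym bv ∷ [-]) (adj-sym ub))

  HasNeighbourIn : Subset n → V G → Set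
  HasNeighbourIn S v = ∃ λ s → s ∈ S × Adj G v s

  hasNeighbourIn? : ∀ S v → Dec (HasNeighbourIn S v)
  hasNeighbourIn? S v = any? λ s → (s ∈? S) ×-dec adj? v s

  hasNeighbourIn-⊆ : S ⊆ T → HasNeighbourIn S v → HasNeighbourIn T v
  hasNeighbourIn-⊆ S⊆T (s , s∈S , vs) = s , S⊆T s∈S , vs

  Dominating : Subset n → Set
  Dominating U = ∀ v → v ∉ U → HasNeighbourIn U v

  independent? : ∀ S → Dec (Independent G S)
  independent? S = all? λ u → all? λ v → (u ∈? S) →-dec ((v ∈? S) →-dec ¬? (adj? u v))

  ⊆-independent : S ⊆ T → Independent G T → Independent G S
  ⊆-independent S⊆T indT u v u∈S v∈S = indT u v (S⊆T u∈S) (S⊆T v∈S)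

  ⁅⁆-independent : ∀ w → Independent G ⁅ w ⁆
  ⁅⁆-independent w u v u∈ v∈ uv
    rewrite x∈⁅y⁆⇒x≡y w u∈ | x∈⁅y⁆⇒x≡y w v∈ = adj⇒≢ uv refl

  ∪-independent : ∀ S T → Independent G S → Independent G T →
                  (∀ s t → s ∈ S → t ∈ T → ¬ Adj G s t) → Independent G (S ∪ T)
  ∪-independent S T indS indT across u v u∈ v∈ with x∈p∪q⁻ S T u∈ | x∈p∪q⁻ S T v∈
  ... | inj₁ u∈S | inj₁ v∈S = indS u v u∈S v∈S
  ... | inj₁ u∈S | inj₂ v∈T = across u v u∈S v∈T
  ... | inj₂ u∈T | inj₁ v∈S = λ uv → across v u v∈S u∈T (adj-sym uv)
  ... | inj₂ u∈T | inj₂ v∈T = indT u v u∈T v∈T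

  insert-independent : ∀ S w → Independent G S → (∀ u → u ∈ S → ¬ Adj G w u) →
                       Independent G (S ∪ ⁅ w ⁆)
  insert-independent S w indS ¬adj = ∪-independent S ⁅ w ⁆ indS (⁅⁆-independent w)
    λ s t s∈S t∈w st → ¬adj s s∈S (subst (λ t → Adj G t s) (x∈⁅y⁆⇒x≡y w t∈w) (adj-sym st))

  ∈-insert : (S : Subset n) (w : V G) → w ∈ S ∪ ⁅ w ⁆
  ∈-insert S w = q⊆p∪q S ⁅ w ⁆ (x∈⁅x⁆ w)

  maximal⇒dominating : MaximalIndependent G U → Dominating U
  maximal⇒dominating {U} (indU , maximal) v v∉U =
    decidable-stable (hasNeighbourIn? U v) λ ¬nb →
      maximal (U ∪ ⁅ v ⁆) (insert-independent U v indU λ u u∈U vu → ¬nb (u , u∈U , vu))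
        (p⊆p∪q ⁅ v ⁆ , λ U≡ → v∉U (subst (v ∈_) (sym U≡) (∈-insert U v)))

  dominating⇒maximal : Independent G U → Dominating U → MaximalIndependent G U
  dominating⇒maximal {U} indU dom = indU , λ T indT (U⊆T , U≢T) →
    U≢T (⊆-antisym U⊆T λ {v} v∈T → decidable-stable (v ∈? U) λ v∉U →
      let (u , u∈U , vu) = dom v v∉U in indT v u v∈T (U⊆T u∈U) vu)

  module _ {P : Pred (V G) 0ℓ} (P? : Decidable P) (T₀ : Subset n) where

    private
      record Extension (L : List (V G)) : Set where
        field
          set         : Subset n
          independent : Independent G set
          ⊇T₀         : T₀ ⊆ set
          ⊆P          : ∀ v → v ∈ set → P v
          dominates   : ∀ v → v ∈ˡ L → P v → v ∉ set → HasNeighbourIn set v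

      keep : ∀ {L} (e : Extension L) → (P v → v ∉ Extension.set e → HasNeighbourIn (Extension.set e) v) →
             Extension (v ∷ L)
      keep e covered = record
        { set = set ; independent = independent ; ⊇T₀ = ⊇T₀ ; ⊆P = ⊆P
        ; dominates = λ { w (here refl) → covered ; w (there w∈L) → dominates w w∈L }
        }
        where open Extension e

      add : ∀ {L} (e : Extension L) → P v → ¬ HasNeighbourIn (Extension.set e) v → Extension (v ∷ L)
      add {v} e Pv ¬nb = record
        { set         = set ∪ ⁅ v ⁆
        ; independent = insert-independent set v independent λ u u∈ vu → ¬nb (u , u∈ , vu)
        ; ⊇T₀         = λ t∈T₀ → p⊆p∪q ⁅ v ⁆ (⊇T₀ t∈T₀)
        ; ⊆P          = λ u u∈ → [ ⊆P u , (λ u∈v → subst P (sym (x∈⁅y⁆⇒x≡y v u∈v)) Pv) ]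
                                  (x∈p∪q⁻ set ⁅ v ⁆ u∈)
        ; dominates   = λ
            { w (here refl) _ w∉ → contradiction (∈-insert set w) w∉
            ; w (there w∈L) Pw w∉ → hasNeighbourIn-⊆ (p⊆p∪q ⁅ v ⁆)
                                      (dominates w w∈L Pw (λ w∈ → w∉ (p⊆p∪q ⁅ v ⁆ w∈)))
            }
        }
        where open Extension e

      extend : Independent G T₀ → (∀ v → v ∈ T₀ → P v) → ∀ L → Extension L
      extend indT₀ T₀⊆P [] = record
        { set = T₀ ; independent = indT₀ ; ⊇T₀ = λ t∈ → t∈ ; ⊆P = T₀⊆P ; dominates = λ _ () }
      extend indT₀ T₀⊆P (v ∷ L) with extend indT₀ T₀⊆P L
      ... | e with hasNeighbourIn? (Extension.set e) v | P? v
      ... | yes nb | _      = keep e λ _ _ → nb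
      ... | no _   | no ¬Pv = keep e λ Pv → contradiction Pv ¬Pv
      ... | no ¬nb | yes Pv = add e Pv ¬nb

    extend-dominating : Independent G T₀ → (∀ v → v ∈ T₀ → P v) →
                        ∃ λ T → Independent G T × T₀ ⊆ T × (∀ v → v ∈ T → P v) ×
                                (∀ v → P v → v ∉ T → HasNeighbourIn T v)
    extend-dominating indT₀ T₀⊆P = set , independent , ⊇T₀ , ⊆P , λ v → dominates v (∈-allFin v)
      where open Extension (extend indT₀ T₀⊆P (allFin n))

  NoCommonNeighbour : V G → V G → Set
  NoCommonNeighbour x y = ∀ z → ¬ (Adj G x z × Adj G y z)

  _∉N[_,_] : V G → V G → V G → Set
  u ∉N[ x , y ] = (u ≢ x × ¬ Adj G x u) × (u ≢ y × ¬ Adj G y u)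

  ∉N[_,_]? : ∀ x y u → Dec (u ∉N[ x , y ])
  ∉N[ x , y ]? u = (¬? (u ≟ x) ×-dec ¬? (adj? x u)) ×-dec (¬? (u ≟ y) ×-dec ¬? (adj? y u))

  NonSheddingWitness : V G → Subset n → Set
  NonSheddingWitness x S = Independent G S × AvoidsClosedNbhd G S x × (∀ a → Adj G x a → HasNeighbourIn S a)

  ¬shedding⇔witness : (¬ Shedding G x) ⇔ ∃ (NonSheddingWitness x)
  ¬shedding⇔witness {x} = mk⇔
    (λ ¬shed → decidable-stable (anySubset? witness?) λ none → ¬shed (no-witness⇒shedding none))
    λ { (S , indS , avoids , dom) shed →
          let (u , xu , indSu) = shed S indS avoids
              (s , s∈S , us)   = dom u xu
          in indSu u s (∈-insert S u) (p⊆p∪q ⁅ u ⁆ s∈S) us }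
    where
    witness? : ∀ S → Dec (NonSheddingWitness x S)
    witness? S = independent? S
      ×-dec all? (λ u → (u ∈? S) →-dec (¬? (u ≟ x) ×-dec ¬? (adj? x u)))
      ×-dec all? (λ a → adj? x a →-dec hasNeighbourIn? S a)

    no-witness⇒shedding : ¬ ∃ (NonSheddingWitness x) → Shedding G x
    no-witness⇒shedding none S indS avoids
      with any? (λ a → adj? x a ×-dec ¬? (hasNeighbourIn? S a))
    ... | yes (a , xa , ¬nb) = a , xa , insert-independent S a indS λ u u∈S au → ¬nb (u , u∈S , au)
    ... | no ¬free = contradiction (S , indS , avoids , λ a xa →
          decidable-stable (hasNeighbourIn? S a) λ ¬nb → ¬free (a , xa , ¬nb)) none

  insert-maximal : ∀ S a → Independent G S → (∀ u → u ∈ S → ¬ Adj G a u) → Adj G b a →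
                   (∀ v → v ∉ S → v ≢ a → v ≢ b → HasNeighbourIn S v) →
                   MaximalIndependent G (S ∪ ⁅ a ⁆)
  insert-maximal {b} S a indS ¬adj ba dom =
    dominating⇒maximal (insert-independent S a indS ¬adj) dominated
    where
    dominated : Dominating (S ∪ ⁅ a ⁆)
    dominated v v∉ with v ≟ a | v ≟ b
    ... | yes refl | _        = contradiction (∈-insert S v) v∉
    ... | no _     | yes refl = a , ∈-insert S a , ba
    ... | no v≢a   | no v≢b   =
      hasNeighbourIn-⊆ (p⊆p∪q ⁅ a ⁆) (dom v (λ v∈S → v∉ (p⊆p∪q ⁅ a ⁆ v∈S)) v≢a v≢b)

  dominating-outside⇒relating : Adj G x y → Independent G S → (∀ u → u ∈ S → u ∉N[ x , y ]) →
                                (∀ v → v ∉ S → v ≢ x → v ≢ y → HasNeighbourIn S v) →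
                                Relating G x y
  dominating-outside⇒relating {x} {y} {S} xy indS far dom =
    S , indS , (λ u u∈ → proj₁ (far u u∈)) , (λ u u∈ → proj₂ (far u u∈)) ,
    insert-maximal S x indS (λ u u∈ → proj₂ (proj₁ (far u u∈))) (adj-sym xy) dom ,
    insert-maximal S y indS (λ u u∈ → proj₂ (proj₂ (far u u∈))) xy
      (λ v v∉ v≢y v≢x → dom v v∉ v≢x v≢y)

  relating-sym : Relating G x y → Relating G y x
  relating-sym (S , indS , avoidsx , avoidsy , maxx , maxy) = S , indS , avoidsy , avoidsx , maxy , maxx

  relating⇒witness : ¬ HasCycle G 5 → Adj G x y → NoCommonNeighbour x y →
                     Adj G y z → z ≢ x → Relating G x y → ∃ (NonSheddingWitness x)
  relating⇒witness {x} {y} {z} ¬C5 xy disjoint yz z≢x (S , indS , avoidsx , avoidsy , _ , maxy) =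
    S∖N[z] ∪ ⁅ z ⁆ , independent , avoids , dominates
    where
    ¬xz : ¬ Adj G x z
    ¬xz xz = disjoint z (xz , yz)

    S∖N[z] : Subset n
    S∖N[z] = toSubset (λ v → (v ∈? S) ×-dec ¬? (adj? z v))

    independent : Independent G (S∖N[z] ∪ ⁅ z ⁆)
    independent = ∪-independent S∖N[z] ⁅ z ⁆
      (⊆-independent (λ v∈ → proj₁ (to (∈-toSubset _) v∈)) indS) (⁅⁆-independent z)
      λ s t s∈ t∈z st → proj₂ (to (∈-toSubset _) s∈) (adj-sym (subst (Adj G s) (x∈⁅y⁆⇒x≡y z t∈z) st))

    avoids : AvoidsClosedNbhd G (S∖N[z] ∪ ⁅ z ⁆) x
    avoids u u∈ with x∈p∪q⁻ S∖N[z] ⁅ z ⁆ u∈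
    ... | inj₁ u∈S∖N[z] = avoidsx u (proj₁ (to (∈-toSubset _) u∈S∖N[z]))
    ... | inj₂ u∈z rewrite x∈⁅y⁆⇒x≡y z u∈z = z≢x , ¬xz

    ∉S∪⁅y⁆ : Adj G x u → u ≢ y → u ∉ S ∪ ⁅ y ⁆
    ∉S∪⁅y⁆ {u} xu u≢y u∈ with x∈p∪q⁻ S ⁅ y ⁆ u∈
    ... | inj₁ u∈S = proj₂ (avoidsx u u∈S) xu
    ... | inj₂ u∈y = u≢y (x∈⁅y⁆⇒x≡y y u∈y)

    -- otherwise x u s z y is a 5-cycle
    ¬zs : Adj G x u → u ≢ y → s ∈ S → Adj G u s → ¬ Adj G z s
    ¬zs {u} {s} xu u≢y s∈S us zs = ¬C5 (cycle (x ∷ u ∷ s ∷ z ∷ y ∷ [])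
      ((adj⇒≢ xu ∷ ≢-sym (proj₁ (avoidsx s s∈S)) ∷ ≢-sym z≢x ∷ adj⇒≢ xy ∷ []) ∷
       (adj⇒≢ us ∷ (λ { refl → ¬xz xu }) ∷ u≢y ∷ []) ∷
       (adj⇒≢ (adj-sym zs) ∷ proj₁ (avoidsy s s∈S) ∷ []) ∷
       (adj⇒≢ (adj-sym yz) ∷ []) ∷ [] ∷ [])
      (xu ∷ us ∷ adj-sym zs ∷ adj-sym yz ∷ [-]) (adj-sym xy))

    dominates : ∀ u → Adj G x u → HasNeighbourIn (S∖N[z] ∪ ⁅ z ⁆) u
    dominates u xu with u ≟ y
    ... | yes refl = z , ∈-insert S∖N[z] z , yz
    ... | no u≢y with maximal⇒dominating maxy u (∉S∪⁅y⁆ xu u≢y)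
    ... | s , s∈ , us with x∈p∪q⁻ S ⁅ y ⁆ s∈
    ... | inj₁ s∈S = s , p⊆p∪q ⁅ z ⁆ (from (∈-toSubset _) (s∈S , ¬zs xu u≢y s∈S us)) , us
    ... | inj₂ s∈y rewrite x∈⁅y⁆⇒x≡y y s∈y = contradiction (xu , adj-sym us) (disjoint u)

  Attached : V G → V G → Subset n → V G → Set
  Attached x y S v = v ∈ S × v ∉N[ x , y ] × ∃ λ a → Adj G x a × Adj G a v

  attached? : ∀ x y S v → Dec (Attached x y S v)
  attached? x y S v = (v ∈? S) ×-dec ∉N[ x , y ]? v ×-dec any? (λ a → adj? x a ×-dec adj? a v)

  witness⇒attached-neighbour : ¬ HasCycle G 4 → Adj G x y → NonSheddingWitness x S →
                               Adj G x a → a ≢ y → ∃ λ s → Attached x y S s × Adj G a s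
  witness⇒attached-neighbour {x} {y} {S} {a} ¬C4 xy (_ , avoids , dom) xa a≢y with dom a xa
  ... | s , s∈S , as with avoids s s∈S
  ... | s≢x , ¬xs = s , (s∈S , ((s≢x , ¬xs) , (λ { refl → ¬xs xy }) , ¬ys) , a , xa , as) , as
    where
    ¬ys : ¬ Adj G y s
    ¬ys ys = a≢y (C4-free⇒common-neighbour-unique ¬C4 (≢-sym s≢x) xa as xy ys)

  -- otherwise x a p q b y is a 6-cycle
  attached-nonadjacent : ∀ {Sx Sy p q} → ¬ HasCycle G 6 → Adj G x y → NoCommonNeighbour x y →
                         Attached x y Sx p → Attached y x Sy q → ¬ Adj G p q
  attached-nonadjacent {x} {y} ¬C6 xy disjoint
    (_ , ((p≢x , ¬xp) , p≢y , ¬yp) , a , xa , ap) (_ , ((q≢y , ¬yq) , q≢x , ¬xq) , b , yb , bq) pq =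
    ¬C6 (cycle (x ∷ a ∷ _ ∷ _ ∷ b ∷ y ∷ [])
      ((adj⇒≢ xa ∷ ≢-sym p≢x ∷ ≢-sym q≢x ∷ (λ { refl → ¬xq bq }) ∷ adj⇒≢ xy ∷ []) ∷
       (adj⇒≢ ap ∷ (λ { refl → ¬xq xa }) ∷ (λ { refl → disjoint a (xa , yb) }) ∷ (λ { refl → ¬yp ap }) ∷ []) ∷
       (adj⇒≢ pq ∷ (λ { refl → ¬yp yb }) ∷ p≢y ∷ []) ∷
       (adj⇒≢ (adj-sym bq) ∷ q≢y ∷ []) ∷
       (adj⇒≢ (adj-sym yb) ∷ []) ∷ [] ∷ [])
      (xa ∷ ap ∷ pq ∷ adj-sym bq ∷ adj-sym yb ∷ [-]) (adj-sym xy))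

  AttachedSet : V G → V G → Subset n → Subset n
  AttachedSet x y S = toSubset (attached? x y S)

  attached⊆⇒dominates-all-but-xy : ¬ HasCycle G 4 → Adj G x y → NonSheddingWitness x Sx → NonSheddingWitness y Sy →
                      AttachedSet x y Sx ∪ AttachedSet y x Sy ⊆ T →
                      (∀ v → v ∉N[ x , y ] → v ∉ T → HasNeighbourIn T v) →
                      ∀ v → v ∉ T → v ≢ x → v ≢ y → HasNeighbourIn T v
  attached⊆⇒dominates-all-but-xy {x} {y} {Sx} {Sy} ¬C4 xy wx wy D⊆T dominates v v∉ v≢x v≢y
    with adj? x v | adj? y v
  ... | yes xv | _ =
    let (s , att , vs) = witness⇒attached-neighbour ¬C4 xy wx xv v≢y
    in s , D⊆T (p⊆p∪q (AttachedSet y x Sy) (from (∈-toSubset _) att)) , vs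
  ... | no _ | yes yv =
    let (s , att , vs) = witness⇒attached-neighbour ¬C4 (adj-sym xy) wy yv v≢x
    in s , D⊆T (q⊆p∪q (AttachedSet x y Sx) _ (from (∈-toSubset _) att)) , vs
  ... | no ¬xv | no ¬yv = dominates v ((v≢x , ¬xv) , v≢y , ¬yv) v∉

  witnesses⇒relating : ¬ HasCycle G 4 → ¬ HasCycle G 6 → Adj G x y → NoCommonNeighbour x y →
                       ∃ (NonSheddingWitness x) → ∃ (NonSheddingWitness y) → Relating G x y
  witnesses⇒relating {x} {y} ¬C4 ¬C6 xy disjoint (Sx , wx) (Sy , wy) =
    let (T , indT , D⊆T , T-outside , T-dominates) =
          extend-dominating ∉N[ x , y ]? (Dx ∪ Dy) D-independent D-outside
    in dominating-outside⇒relating xy indT T-outside (attached⊆⇒dominates-all-but-xy ¬C4 xy wx wy D⊆T T-dominates)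
    where
    Dx Dy : Subset n
    Dx = AttachedSet x y Sx
    Dy = AttachedSet y x Sy

    D-independent : Independent G (Dx ∪ Dy)
    D-independent = ∪-independent Dx Dy
      (⊆-independent (λ v∈ → proj₁ (to (∈-toSubset _) v∈)) (proj₁ wx))
      (⊆-independent (λ v∈ → proj₁ (to (∈-toSubset _) v∈)) (proj₁ wy))
      λ p q p∈ q∈ → attached-nonadjacent ¬C6 xy disjoint (to (∈-toSubset _) p∈) (to (∈-toSubset _) q∈)

    D-outside : ∀ v → v ∈ Dx ∪ Dy → v ∉N[ x , y ]
    D-outside v v∈ with x∈p∪q⁻ Dx Dy v∈
    ... | inj₁ v∈Dx = proj₁ (proj₂ (to (∈-toSubset _) v∈Dx))
    ... | inj₂ v∈Dy = swap (proj₁ (proj₂ (to (∈-toSubset _) v∈Dy)))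

theorem2p4 : (G : Graph) →
    ¬ HasCycle G 4 → ¬ HasCycle G 5 → ¬ HasCycle G 6 →
    ∀ x y → Adj G x y →
    (∀ z → ¬ (Adj G x z × Adj G y z)) →
    2 ≤ deg G x → 2 ≤ deg G y →
    ((¬ Shedding G x × ¬ Shedding G y) ⇔ Relating G x y)
theorem2p4 G ¬C4 ¬C5 ¬C6 x y xy disjoint 2≤deg-x 2≤deg-y = mk⇔
  (λ (¬shed-x , ¬shed-y) → witnesses⇒relating ¬C4 ¬C6 xy disjoint
     (to ¬shedding⇔witness ¬shed-x) (to ¬shedding⇔witness ¬shed-y))
  (λ relating →
     let (z , yz , z≢x) = deg≥2⇒other-neighbour x y 2≤deg-y
         (w , xw , w≢y) = deg≥2⇒other-neighbour y x 2≤deg-x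
     in from ¬shedding⇔witness (relating⇒witness ¬C5 xy disjoint yz z≢x relating) ,
        from ¬shedding⇔witness
          (relating⇒witness ¬C5 (adj-sym xy) (λ v → disjoint v ∘ swap) xw w≢y (relating-sym relating)))
  where open Properties G
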